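{- Let $X$ be a finite set with $|X|\ge3$ and $\mathfrak{C}$ the set of partial choice functions on pairs from $X$. If $\mathscr{C}\subseteq\mathfrak{C}$ is symmetric, balanced and nontrivial, then every $d\in\operatorname{maj}^{\mathrm{cl}}(\mathscr{C})$ is pseudo-balanced.
   Context: $\mathfrak{C}$ is the set of all functions $c\colon Y\to X$ with $Y\subseteq\binom{X}{2}$ and $c\{x,y\}\in\{x,y\}$. $W^x_y(c)$ is $1$ if $c\{x,y\}=x$, $-1$ if $c\{x,y\}=y$, $0$ if $\{x,y\}\notin\operatorname{dom}c$ (including $x=y$). $\mathscr{C}$ is symmetric if closed under $c\mapsto c^\sigma$ for permutations $\sigma$ of $X$, where $c^\sigma\{\sigma(x),\sigma(y)\}=\sigma(x)$ iff $c\{x,y\}=x$. $c$ is balanced if $\sum_{y}W^x_y(c)=0$ for all $x$; $\mathscr{C}$ is balanced if all its members are. $\mathscr{C}$ is trivial if $\mathscr{C}=\emptyset$ or $\mathscr{C}=\{c\}$ with $\operatorname{dom}c=\emptyset$. $\operatorname{maj}^{\mathrm{cl}}(\mathscr{C})$ is the set of $d\in\mathfrak{C}$ for which there are rationals $r_c\in[0,1]$ with $\sum_c r_c=1$ and $d\{x,y\}=x\iff\sum_c W^x_y(c)r_c>0$. $\operatorname{tor}(d)$ is the directed graph on $X$ with edge $a\to b$ iff $d\{a,b\}=a$; $d$ is pseudo-balanced if every edge of $\operatorname{tor}(d)$ lies on a directed cycle. -}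

module Defs where

open import Data.Nat using (ℕ; zero; suc)
open import Data.Fin using (Fin; zero; suc; _≟_)
open import Data.Fin.Permutation using (Permutation′; _⟨$⟩ʳ_; _⟨$⟩ˡ_; inverseʳ)
open import Data.Maybe using (Maybe; just; nothing)
import Data.Maybe as Maybe
open import Data.Integer using (ℤ; +_; -[1+_])
import Data.Integer as ℤ
open import Data.Rational using (ℚ; 0ℚ; 1ℚ; _≤_; _<_; _/_)
import Data.Rational as ℚ
open import Data.List using (List; []; _∷_; length; lookup)
open import Data.List.Relation.Unary.Any using (Any)
open import Data.List.Relation.Unary.All using (All)
open import Data.List.Relation.Unary.Unique.Propositional using (Unique)
open import Data.Product using (Σ; ∃; ∃-syntax; _×_; _,_)
open import Data.Sum using (_⊎_; inj₁; inj₂)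
open import Data.Empty using (⊥)
open import Relation.Nullary using (¬_; yes; no)
open import Relation.Binary.PropositionalEquality
  using (_≡_; refl; sym; trans; cong)
open import Function.Bundles using (_⇔_)

-- X = Fin n.  A partial choice function c : Y → X, Y ⊆ (X choose 2),
-- encoded on ordered pairs: ch x y = just z means {x,y} ∈ dom c and
-- c{x,y} = z; ch x y = nothing means {x,y} ∉ dom c.
record ChoiceFn (n : ℕ) : Set where
  field
    ch     : Fin n → Fin n → Maybe (Fin n)
    irrefl : ∀ x → ch x x ≡ nothing
    unord  : ∀ x y → ch x y ≡ ch y x
    valid  : ∀ x y z → ch x y ≡ just z → z ≡ x ⊎ z ≡ y
open ChoiceFn public

_≈_ : ∀ {n} → ChoiceFn n → ChoiceFn n → Set
c ≈ c' = ∀ x y → ch c x y ≡ ch c' x y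

-- membership in a family 𝒞 ⊆ 𝔊, represented as a (finite) list
_∈𝒞_ : ∀ {n} → ChoiceFn n → List (ChoiceFn n) → Set
c ∈𝒞 𝒞 = Any (c ≈_) 𝒞

W : ∀ {n} → ChoiceFn n → Fin n → Fin n → ℤ
W c x y with ch c x y
... | nothing = + 0
... | just z with z ≟ x
...   | yes _ = + 1
...   | no _  = -[1+ 0 ]

sumFin : ∀ {A : Set} (zeroA : A) (plus : A → A → A) (m : ℕ) → (Fin m → A) → A
sumFin z p zero    f = z
sumFin z p (suc m) f = p (f zero) (sumFin z p m (λ i → f (suc i)))

sumℤ : ∀ m → (Fin m → ℤ) → ℤ
sumℤ = sumFin (+ 0) ℤ._+_

sumℚ : ∀ m → (Fin m → ℚ) → ℚ
sumℚ = sumFin 0ℚ ℚ._+_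

map-nothing : ∀ {A B : Set} (f : A → B) {m : Maybe A} → m ≡ nothing → Maybe.map f m ≡ nothing
map-nothing f refl = refl

map-just : ∀ {A B : Set} (f : A → B) (m : Maybe A) {b} → Maybe.map f m ≡ just b →
           ∃[ a ] (m ≡ just a × f a ≡ b)
map-just f (just a) refl = a , refl , refl

_^_ : ∀ {n} → ChoiceFn n → Permutation′ n → ChoiceFn n
ch (c ^ σ) u v = Maybe.map (σ ⟨$⟩ʳ_) (ch c (σ ⟨$⟩ˡ u) (σ ⟨$⟩ˡ v))
irrefl (c ^ σ) u = map-nothing (σ ⟨$⟩ʳ_) (irrefl c (σ ⟨$⟩ˡ u))
unord (c ^ σ) u v = cong (Maybe.map (σ ⟨$⟩ʳ_)) (unord c (σ ⟨$⟩ˡ u) (σ ⟨$⟩ˡ v))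
valid (c ^ σ) u v z eq with map-just (σ ⟨$⟩ʳ_) _ eq
... | a , e , fa with valid c _ _ a e
...   | inj₁ a≡ = inj₁ (trans (sym fa) (trans (cong (σ ⟨$⟩ʳ_) a≡) (inverseʳ σ)))
...   | inj₂ a≡ = inj₂ (trans (sym fa) (trans (cong (σ ⟨$⟩ʳ_) a≡) (inverseʳ σ)))

Symmetric : ∀ {n} → List (ChoiceFn n) → Set
Symmetric {n} 𝒞 = ∀ c → c ∈𝒞 𝒞 → (σ : Permutation′ n) → (c ^ σ) ∈𝒞 𝒞

BalancedFn : ∀ {n} → ChoiceFn n → Set
BalancedFn {n} c = ∀ x → sumℤ n (λ y → W c x y) ≡ + 0

Balanced : ∀ {n} → List (ChoiceFn n) → Set
Balanced 𝒞 = ∀ c → c ∈𝒞 𝒞 → BalancedFn c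

EmptyDom : ∀ {n} → ChoiceFn n → Set
EmptyDom c = ∀ x y → ch c x y ≡ nothing

Trivial : ∀ {n} → List (ChoiceFn n) → Set
Trivial 𝒞 = (∀ c → ¬ (c ∈𝒞 𝒞))
          ⊎ (∃[ c ] (EmptyDom c × c ∈𝒞 𝒞 × (∀ c' → c' ∈𝒞 𝒞 → c' ≈ c)))

toℚ : ℤ → ℚ
toℚ k = k / 1

-- d ∈ maj^cl(𝒞): rational weights r_c ∈ [0,1], one per member of the list 𝒞
-- (duplicates in the list merely split a weight), Σ r_c = 1 and
-- d{x,y} = x ⇔ Σ_c W^x_y(c) r_c > 0.
_∈majcl_ : ∀ {n} → ChoiceFn n → List (ChoiceFn n) → Set
_∈majcl_ {n} d 𝒞 =
  Σ (Fin (length 𝒞) → ℚ) λ r →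
    (∀ i → 0ℚ ≤ r i × r i ≤ 1ℚ)
    × sumℚ (length 𝒞) r ≡ 1ℚ
    × (∀ x y → (ch d x y ≡ just x) ⇔
                (0ℚ < sumℚ (length 𝒞) (λ i → toℚ (W (lookup 𝒞 i) x y) ℚ.* r i)))

Edge : ∀ {n} → ChoiceFn n → Fin n → Fin n → Set
Edge d a b = ch d a b ≡ just a

data Walk {A : Set} (E : A → A → Set) : A → A → List A → Set where
  stop : ∀ {x} → Walk E x x (x ∷ [])
  step : ∀ {x y z vs} → E x y → Walk E y z vs → Walk E x z (x ∷ vs)

-- the edge a → b lies on a directed cycle: a → b followed by a simple
-- path (pairwise distinct vertices) from b back to a
OnCycle : ∀ {A : Set} (E : A → A → Set) → A → A → Set
OnCycle E a b = ∃[ vs ] (Walk E b a vs × Unique vs)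

PseudoBalanced : ∀ {n} → ChoiceFn n → Set
PseudoBalanced d = ∀ a b → Edge d a b → OnCycle (Edge d) a b

module Submission where

-- Let d ∈ maj^cl(𝒞) with weights r, and let  m(x,y) = Σ_c W^x_y(c)·r_c  be
-- the weighted majority margin, so that  d{x,y} = x  iff  m(x,y) > 0.  The
-- margin is antisymmetric (W^x_y = -W^y_x) and, because every c ∈ 𝒞 is
-- balanced, every row sums to zero: m is a circulation on X.  For a
-- circulation the net flow out of any set S ⊆ X vanishes, so if positive
-- flow leaves S along some edge then positive flow also enters S along some
-- edge (the cut lemma).  Given an edge a → b of tor(d) we grow a set L ∋ a of
-- vertices joined to a by simple paths inside L; as long as b ∉ L the cut
-- lemma for S = L yields an edge x → y of tor(d) with x ∉ L, y ∈ L, which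
-- extends L.  Since |L| ≤ |X| this stops with b ∈ L, i.e. a simple path
-- b ⇝ a closing the cycle through a → b.

open import Defs
open import Data.Nat using (ℕ; zero; suc; _+_)
import Data.Nat as ℕ
import Data.Nat.Properties as ℕ
open import Data.Fin using (Fin; zero; suc; _≟_)
import Data.Fin as Fin
import Data.Fin.Properties as Fin
open import Data.Bool using (Bool; true; false; _∧_; not; if_then_else_)
open import Data.Maybe using (just; nothing)
open import Data.Integer using (ℤ; +_; -[1+_])
import Data.Integer as ℤ
import Data.Integer.Properties as ℤ
open import Data.Rational using (ℚ; 0ℚ; _≤_; _<_; _/_; mkℚ; -_)
  renaming (_+_ to _+ℚ_; _*_ to _*ℚ_)
open import Data.Rational.Properties
  using (+-*-ring; +-0-group; ↥p/↧p≡p; neg-distrib-+; neg-distribˡ-*; *-zeroˡ;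
         +-identityˡ; +-identityʳ; +-mono-≤; ≤-refl; ≤-trans; <-≤-trans;
         ≮⇒≥; ≤-reflexive; <-irrefl; <-asym; <-cmp; _<?_; neg-antimono-<; neg-antimono-≤)
import Data.Nat.Coprimality as Coprime
open import Data.List using (List; []; _∷_; length; lookup)
open import Data.List.Relation.Unary.Any using (here; there)
open import Data.List.Relation.Unary.All as All using (All; []; _∷_)
open import Data.List.Relation.Unary.AllPairs using ([]; _∷_)
open import Data.List.Relation.Unary.Unique.Propositional using (Unique)
open import Data.List.Membership.Propositional using (_∈_; _∉_)
open import Data.List.Membership.Propositional.Properties using (∈-lookup)
open import Data.Product using (∃-syntax; _×_; _,_)
open import Data.Sum using (inj₁; inj₂)
open import Data.Empty using (⊥-elim)
open import Relation.Nullary using (¬_; Dec; yes; no; ¬?; _×-dec_; contradiction)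
open import Relation.Unary using (Pred; Decidable)
open import Relation.Binary using (tri<; tri≈; tri>)
open import Relation.Binary.PropositionalEquality
open import Function.Bundles using (Equivalence)
open import Algebra.Bundles using (Ring)
open import Algebra.Properties.Group +-0-group using (⁻¹-involutive)
open import Algebra.Properties.Semiring.Sum (Ring.semiring +-*-ring)
  using (sum; ∑-comm; ∑-distrib-+; sum-replicate-zero; *-distribʳ-sum; sum-cong-≗)

-- The sums of Defs agree with the library's summation over the ring ℚ,
-- whose linearity lemmas we then reuse.
sumℚ≡sum : ∀ m (f : Fin m → ℚ) → sumℚ m f ≡ sum f
sumℚ≡sum zero    f = refl
sumℚ≡sum (suc m) f = cong (f zero +ℚ_) (sumℚ≡sum m (λ i → f (suc i)))

sum-neg : ∀ {m} (f : Fin m → ℚ) → sum (λ i → - f i) ≡ - sum f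
sum-neg {zero}  f = refl
sum-neg {suc m} f = trans (cong (- f zero +ℚ_) (sum-neg (λ i → f (suc i))))
                          (sym (neg-distrib-+ (f zero) _))

sum-nonneg : ∀ {m} (f : Fin m → ℚ) → (∀ i → 0ℚ ≤ f i) → 0ℚ ≤ sum f
sum-nonneg {zero}  f nonneg = ≤-refl
sum-nonneg {suc m} f nonneg =
  subst (_≤ sum f) (+-identityʳ 0ℚ)
        (+-mono-≤ (nonneg zero) (sum-nonneg (λ i → f (suc i)) (λ i → nonneg (suc i))))

term≤sum : ∀ {m} (f : Fin m → ℚ) → (∀ i → 0ℚ ≤ f i) → ∀ k → f k ≤ sum f
term≤sum {suc m} f nonneg zero =
  subst (_≤ sum f) (+-identityʳ (f zero))
        (+-mono-≤ (≤-refl {f zero}) (sum-nonneg (λ i → f (suc i)) (λ i → nonneg (suc i))))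
term≤sum {suc m} f nonneg (suc k) =
  subst (_≤ sum f) (+-identityˡ (f (suc k)))
        (+-mono-≤ (nonneg zero) (term≤sum (λ i → f (suc i)) (λ i → nonneg (suc i)) k))

self-negating⇒zero : ∀ p → p ≡ - p → p ≡ 0ℚ
self-negating⇒zero p p≡-p with <-cmp p 0ℚ
... | tri≈ _ p≡0 _ = p≡0
... | tri< p<0 _ _ = ⊥-elim (<-asym p<0 (subst (0ℚ <_) (sym p≡-p) (neg-antimono-< p<0)))
... | tri> _ _ 0<p = ⊥-elim (<-asym 0<p (subst (_< 0ℚ) (sym p≡-p) (neg-antimono-< 0<p)))

-- k / 1 is the rational with numerator k and denominator 1 on the nose;
-- on such representatives addition computes to  (a·1 + b·1) / (1·1).
toℚ-normal : ∀ k → toℚ k ≡ mkℚ k 0 (Coprime.sym (Coprime.1-coprimeTo ℤ.∣ k ∣))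
toℚ-normal k = ↥p/↧p≡p (mkℚ k 0 (Coprime.sym (Coprime.1-coprimeTo ℤ.∣ k ∣)))

toℚ-+ : ∀ a b → toℚ (a ℤ.+ b) ≡ toℚ a +ℚ toℚ b
toℚ-+ a b = begin
  toℚ (a ℤ.+ b)                    ≡⟨ cong (λ k → k / 1) (sym (cong₂ ℤ._+_ (ℤ.*-identityʳ a) (ℤ.*-identityʳ b))) ⟩
  (a ℤ.* + 1 ℤ.+ b ℤ.* + 1) / 1    ≡⟨ sym (cong₂ _+ℚ_ (toℚ-normal a) (toℚ-normal b)) ⟩
  toℚ a +ℚ toℚ b                   ∎
  where open ≡-Reasoning

toℚ-sum : ∀ m (f : Fin m → ℤ) → toℚ (sumℤ m f) ≡ sum (λ i → toℚ (f i))
toℚ-sum zero    f = refl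
toℚ-sum (suc m) f =
  trans (toℚ-+ (f zero) _) (cong (toℚ (f zero) +ℚ_) (toℚ-sum m (λ i → f (suc i))))

toℚ-neg : ∀ k → toℚ (ℤ.- k) ≡ - toℚ k
toℚ-neg (+ zero)  = refl
toℚ-neg (+ suc k) = refl
toℚ-neg -[1+ k ]  = sym (⁻¹-involutive (toℚ (+ suc k)))

module _ {n} (c : ChoiceFn n) where

  W-abstain : ∀ x y → ch c x y ≡ nothing → W c x y ≡ + 0
  W-abstain x y e with ch c x y
  W-abstain x y refl | nothing = refl

  W-winner : ∀ x y → ch c x y ≡ just x → W c x y ≡ + 1
  W-winner x y e with ch c x y
  W-winner x y refl | just _ with x ≟ x
  ... | yes _   = refl
  ... | no x≢x = contradiction refl x≢x

  W-loser : ∀ x y → ch c x y ≡ just y → ¬ x ≡ y → W c x y ≡ -[1+ 0 ]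
  W-loser x y e x≢y with ch c x y
  W-loser x y refl x≢y | just _ with y ≟ x
  ... | yes y≡x = contradiction (sym y≡x) x≢y
  ... | no _    = refl

  decided⇒distinct : ∀ x y z → ch c x y ≡ just z → ¬ x ≡ y
  decided⇒distinct x .x z e refl with trans (sym e) (irrefl c x)
  ... | ()

  W-antisym : ∀ x y → W c x y ≡ ℤ.- W c y x
  W-antisym x y = by-decision (ch c x y) refl
    where
    by-decision : ∀ m → ch c x y ≡ m → W c x y ≡ ℤ.- W c y x
    by-decision nothing e
      rewrite W-abstain x y e | W-abstain y x (trans (unord c y x) e) = refl
    by-decision (just z) e with valid c x y z e
    ... | inj₁ refl
      rewrite W-winner x y e
            | W-loser y x (trans (unord c y x) e) (λ y≡x → decided⇒distinct x y z e (sym y≡x))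
            = refl
    ... | inj₂ refl
      rewrite W-loser x y e (decided⇒distinct x y z e)
            | W-winner y x (trans (unord c y x) e)
            = refl

record Circulation (n : ℕ) : Set where
  field
    flow      : Fin n → Fin n → ℚ
    antisym   : ∀ x y → flow x y ≡ - flow y x
    conserved : ∀ x → sum (flow x) ≡ 0ℚ

keep : Bool → ℚ → ℚ
keep b q = if b then q else 0ℚ

keep-split : ∀ s t q → keep (s ∧ t) q +ℚ keep (s ∧ not t) q ≡ keep s q
keep-split true true  q = +-identityʳ q
keep-split true false q = +-identityˡ q
keep-split false t    q = +-identityʳ 0ℚ

keep-swap-neg : ∀ s t q → keep (s ∧ t) (- q) ≡ - keep (t ∧ s) q
keep-swap-neg true  true  q = refl
keep-swap-neg true  false q = refl
keep-swap-neg false true  q = refl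
keep-swap-neg false false q = refl

module CutLemma {n} (C : Circulation n) {ℓ} {S : Pred (Fin n) ℓ} (S? : Decidable S) where
  open Circulation C

  ∈S : Fin n → Bool
  ∈S x = Dec.does (S? x)

  internal outgoing : Fin n → Fin n → ℚ
  internal x y = keep (∈S x ∧ ∈S y) (flow x y)
  outgoing x y = keep (∈S x ∧ not (∈S y)) (flow x y)

  total : (Fin n → Fin n → ℚ) → ℚ
  total g = sum (λ x → sum (g x))

  -- by antisymmetry the flow within S cancels out
  total-internal : total internal ≡ 0ℚ
  total-internal = self-negating⇒zero (total internal) (begin
    total internal                                   ≡⟨ ∑-comm internal ⟩
    sum (λ y → sum (λ x → internal x y))             ≡⟨ sum-cong-≗ (λ y → sum-cong-≗ (λ x → internal-antisym x y)) ⟩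
    sum (λ y → sum (λ x → - internal y x))           ≡⟨ sum-cong-≗ (λ y → sum-neg (internal y)) ⟩
    sum (λ y → - sum (internal y))                   ≡⟨ sum-neg (λ y → sum (internal y)) ⟩
    - total internal                                 ∎)
    where
    open ≡-Reasoning
    internal-antisym : ∀ x y → internal x y ≡ - internal y x
    internal-antisym x y =
      trans (cong (keep (∈S x ∧ ∈S y)) (antisym x y)) (keep-swap-neg (∈S x) (∈S y) (flow y x))

  -- summing the rows of the vertices of S
  total-internal+outgoing : total internal +ℚ total outgoing ≡ 0ℚ
  total-internal+outgoing = begin
    total internal +ℚ total outgoing                       ≡⟨ sym (∑-distrib-+ (λ x → sum (internal x)) _) ⟩
    sum (λ x → sum (internal x) +ℚ sum (outgoing x))       ≡⟨ sum-cong-≗ (λ x → sym (∑-distrib-+ (internal x) _)) ⟩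
    sum (λ x → sum (λ y → internal x y +ℚ outgoing x y))   ≡⟨ sum-cong-≗ (λ x → sum-cong-≗ (λ y → keep-split (∈S x) (∈S y) (flow x y))) ⟩
    sum (λ x → sum (λ y → keep (∈S x) (flow x y)))          ≡⟨ sum-cong-≗ (λ x → row-in-S (∈S x) x) ⟩
    sum {n} (λ _ → 0ℚ)                                     ≡⟨ sum-replicate-zero n ⟩
    0ℚ                                                     ∎
    where
    open ≡-Reasoning
    row-in-S : ∀ b x → sum (λ y → keep b (flow x y)) ≡ 0ℚ
    row-in-S true  x = conserved x
    row-in-S false x = sum-replicate-zero n

  total-outgoing : total outgoing ≡ 0ℚ
  total-outgoing = begin
    total outgoing                    ≡⟨ sym (+-identityˡ _) ⟩
    0ℚ +ℚ total outgoing              ≡⟨ cong (_+ℚ total outgoing) (sym total-internal) ⟩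
    total internal +ℚ total outgoing  ≡⟨ total-internal+outgoing ⟩
    0ℚ                                ∎
    where open ≡-Reasoning

  cut-lemma : ∀ {a b} → S a → ¬ S b → 0ℚ < flow a b →
              ∃[ x ] ∃[ y ] (¬ S x × S y × 0ℚ < flow x y)
  cut-lemma {a} {b} a∈S b∉S 0<ab
    with Fin.any? (λ x → Fin.any? (λ y → ¬? (S? x) ×-dec S? y ×-dec 0ℚ <? flow x y))
  ... | yes (x , y , x∉S , y∈S , 0<xy) = x , y , x∉S , y∈S , 0<xy
  ... | no none = ⊥-elim (<-irrefl refl (<-≤-trans 0<ab (≤-trans ab≤total (≤-reflexive total-outgoing))))
    where
    outgoing-nonneg : ∀ x y → 0ℚ ≤ outgoing x y
    outgoing-nonneg x y with S? x | S? y
    ... | yes x∈S | no y∉S =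
      subst (0ℚ ≤_) (sym (antisym x y))
            (neg-antimono-≤ (≮⇒≥ (λ 0<yx → none (y , x , y∉S , x∈S , 0<yx))))
    ... | yes _ | yes _ = ≤-refl
    ... | no _  | _     = ≤-refl
    outgoing-ab : outgoing a b ≡ flow a b
    outgoing-ab with S? a | S? b
    ... | yes _    | no _    = refl
    ... | yes _    | yes b∈S = contradiction b∈S b∉S
    ... | no a∉S   | _       = contradiction a∈S a∉S
    ab≤total : flow a b ≤ total outgoing
    ab≤total = subst (_≤ total outgoing) outgoing-ab
      (≤-trans (term≤sum (outgoing a) (outgoing-nonneg a) b)
               (term≤sum (λ x → sum (outgoing x))
                         (λ x → sum-nonneg (outgoing x) (outgoing-nonneg x)) a))

unique⇒lookup-distinct : ∀ {A : Set} {xs : List A} → Unique xs →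
  ∀ {i j} → i Fin.< j → ¬ lookup xs i ≡ lookup xs j
unique⇒lookup-distinct {xs = x ∷ xs} (x∉xs ∷ _) {zero} {suc j} _ = All.lookup x∉xs (∈-lookup j)
unique⇒lookup-distinct {xs = x ∷ xs} (_ ∷ u) {suc i} {suc j} (ℕ.s≤s i<j) =
  unique⇒lookup-distinct u i<j

-- By the pigeonhole principle a list of distinct elements of Fin n has at
-- most n entries; this bounds the growth of the basin below.
unique⇒length≤ : ∀ {n} {xs : List (Fin n)} → Unique xs → length xs ℕ.≤ n
unique⇒length≤ {xs = xs} u = ℕ.≮⇒≥ λ n<length →
  let i , j , i<j , same = Fin.pigeonhole n<length (lookup xs)
  in unique⇒lookup-distinct u i<j same

module PositiveEdgesOnCycles {n} (C : Circulation n) (E : Fin n → Fin n → Set)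
    (positive⇒edge : ∀ x y → 0ℚ < Circulation.flow C x y → E x y) where
  open Circulation C
  open import Data.List.Membership.DecPropositional (_≟_ {n}) using (_∈?_)

  PathWithin : Fin n → List (Fin n) → Fin n → Set
  PathWithin a L x = ∃[ vs ] (Walk E x a vs × Unique vs × All (_∈ L) vs)

  forget-within : ∀ {a L x} → PathWithin a L x → ∃[ vs ] (Walk E x a vs × Unique vs)
  forget-within (vs , w , u , _) = vs , w , u

  record Basin (a : Fin n) (L : List (Fin n)) : Set where
    field
      distinct : Unique L
      reaches  : ∀ {x} → x ∈ L → PathWithin a L x
  open Basin

  basin-root : ∀ a → Basin a (a ∷ [])
  basin-root a = record
    { distinct = [] ∷ []
    ; reaches  = λ { (here refl) → a ∷ [] , stop , [] ∷ [] , here refl ∷ [] } }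

  private
    fresh : ∀ {x} {L vs : List (Fin n)} → x ∉ L → All (_∈ L) vs → All (λ v → ¬ x ≡ v) vs
    fresh x∉L = All.map (λ v∈L x≡v → x∉L (subst (_∈ _) (sym x≡v) v∈L))

  grow : ∀ {a L x y} → Basin a L → x ∉ L → y ∈ L → E x y → Basin a (x ∷ L)
  grow {a} {L} {x} {y} B x∉L y∈L x→y = record
    { distinct = fresh x∉L (All.tabulate (λ v∈L → v∈L)) ∷ distinct B
    ; reaches  = path }
    where
    path : ∀ {z} → z ∈ x ∷ L → PathWithin a (x ∷ L) z
    path (here refl) with reaches B y∈L
    ... | vs , w , u , inside = x ∷ vs , step x→y w , fresh x∉L inside ∷ u , here refl ∷ All.map there inside
    path (there z∈L) with reaches B z∈L
    ... | vs , w , u , inside = vs , w , u , All.map there inside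

  -- grow the basin of a until it contains b; k bounds the remaining steps
  close : ∀ {a b} → 0ℚ < flow a b → ∀ k L → Basin a L → a ∈ L → n ℕ.< length L + k →
          ∃[ vs ] (Walk E b a vs × Unique vs)
  close {a} {b} 0<ab k L B a∈L bound with b ∈? L
  ... | yes b∈L = forget-within (reaches B b∈L)
  close 0<ab zero L B a∈L bound | no b∉L =
    contradiction (subst (n ℕ.<_) (ℕ.+-identityʳ (length L)) bound)
                  (ℕ.≤⇒≯ (unique⇒length≤ (distinct B)))
  close 0<ab (suc k) L B a∈L bound | no b∉L
    with CutLemma.cut-lemma C {S = _∈ L} (_∈? L) a∈L b∉L 0<ab
  ... | x , y , x∉L , y∈L , 0<xy =
    close 0<ab k (x ∷ L) (grow B x∉L y∈L (positive⇒edge x y 0<xy)) (there a∈L)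
          (subst (n ℕ.<_) (ℕ.+-suc (length L) k) bound)

  -- start from the basin {a}; n steps suffice since a basin has ≤ n vertices
  positive⇒on-cycle : ∀ a b → 0ℚ < flow a b → OnCycle E a b
  positive⇒on-cycle a b 0<ab = close 0<ab n (a ∷ []) (basin-root a) (here refl) ℕ.≤-refl

lookup-∈𝒞 : ∀ {n} (𝒞 : List (ChoiceFn n)) i → lookup 𝒞 i ∈𝒞 𝒞
lookup-∈𝒞 (c ∷ 𝒞) zero    = here (λ x y → refl)
lookup-∈𝒞 (c ∷ 𝒞) (suc i) = there (lookup-∈𝒞 𝒞 i)

module _ {n} (𝒞 : List (ChoiceFn n)) (r : Fin (length 𝒞) → ℚ) where

  margin : Fin n → Fin n → ℚ
  margin x y = sum (λ i → toℚ (W (lookup 𝒞 i) x y) *ℚ r i)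

  margin-antisym : ∀ x y → margin x y ≡ - margin y x
  margin-antisym x y = begin
    margin x y                                               ≡⟨ sum-cong-≗ term-antisym ⟩
    sum (λ i → - (toℚ (W (lookup 𝒞 i) y x) *ℚ r i))          ≡⟨ sum-neg {length 𝒞} _ ⟩
    - margin y x                                             ∎
    where
    open ≡-Reasoning
    term-antisym : ∀ i → toℚ (W (lookup 𝒞 i) x y) *ℚ r i ≡ - (toℚ (W (lookup 𝒞 i) y x) *ℚ r i)
    term-antisym i = begin
      toℚ (W c x y) *ℚ r i            ≡⟨ cong (λ k → toℚ k *ℚ r i) (W-antisym c x y) ⟩
      toℚ (ℤ.- W c y x) *ℚ r i        ≡⟨ cong (_*ℚ r i) (toℚ-neg (W c y x)) ⟩
      - toℚ (W c y x) *ℚ r i          ≡⟨ sym (neg-distribˡ-* (toℚ (W c y x)) (r i)) ⟩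
      - (toℚ (W c y x) *ℚ r i)        ∎
      where c = lookup 𝒞 i

  -- each row of the margin is a weighted sum of rows of balanced functions
  margin-conserved : Balanced 𝒞 → ∀ x → sum (margin x) ≡ 0ℚ
  margin-conserved balanced x = begin
    sum (λ y → sum (λ i → toℚ (W (lookup 𝒞 i) x y) *ℚ r i))  ≡⟨ ∑-comm (λ y i → toℚ (W (lookup 𝒞 i) x y) *ℚ r i) ⟩
    sum (λ i → sum (λ y → toℚ (W (lookup 𝒞 i) x y) *ℚ r i))  ≡⟨ sum-cong-≗ (λ i → sym (*-distribʳ-sum (r i) (λ y → toℚ (W (lookup 𝒞 i) x y)))) ⟩
    sum (λ i → sum (λ y → toℚ (W (lookup 𝒞 i) x y)) *ℚ r i)  ≡⟨ sum-cong-≗ row-zero ⟩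
    sum {length 𝒞} (λ _ → 0ℚ)                               ≡⟨ sum-replicate-zero (length 𝒞) ⟩
    0ℚ                                                      ∎
    where
    open ≡-Reasoning
    row-zero : ∀ i → sum (λ y → toℚ (W (lookup 𝒞 i) x y)) *ℚ r i ≡ 0ℚ
    row-zero i = begin
      sum (λ y → toℚ (W c x y)) *ℚ r i   ≡⟨ cong (_*ℚ r i) (sym (toℚ-sum n (W c x))) ⟩
      toℚ (sumℤ n (W c x)) *ℚ r i         ≡⟨ cong (λ k → toℚ k *ℚ r i) (balanced c (lookup-∈𝒞 𝒞 i) x) ⟩
      0ℚ *ℚ r i                           ≡⟨ *-zeroˡ (r i) ⟩
      0ℚ                                  ∎
      where c = lookup 𝒞 i

  margin-circulation : Balanced 𝒞 → Circulation n
  margin-circulation balanced = record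
    { flow = margin ; antisym = margin-antisym ; conserved = margin-conserved balanced }

-- The edges of tor(d) are exactly the positive edges of the margin, so
-- every edge lies on a cycle.
mainTheorem4 : (n : ℕ) → 3 ℕ.≤ n → (𝒞 : List (ChoiceFn n)) →
    Symmetric 𝒞 → Balanced 𝒞 → ¬ Trivial 𝒞 →
    (d : ChoiceFn n) → d ∈majcl 𝒞 → PseudoBalanced d
mainTheorem4 n _ 𝒞 _ balanced _ d (r , _ , _ , majority) a b a→b =
  PositiveEdgesOnCycles.positive⇒on-cycle (margin-circulation 𝒞 r balanced) (Edge d)
    positive⇒edge a b (edge⇒positive a b a→b)
  where
  margin-is-sumℚ : ∀ x y → sumℚ (length 𝒞) (λ i → toℚ (W (lookup 𝒞 i) x y) *ℚ r i) ≡ margin 𝒞 r x y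
  margin-is-sumℚ x y = sumℚ≡sum (length 𝒞) _
  positive⇒edge : ∀ x y → 0ℚ < margin 𝒞 r x y → Edge d x y
  positive⇒edge x y 0<m = Equivalence.from (majority x y) (subst (0ℚ <_) (sym (margin-is-sumℚ x y)) 0<m)
  edge⇒positive : ∀ x y → Edge d x y → 0ℚ < margin 𝒞 r x y
  edge⇒positive x y e = subst (0ℚ <_) (margin-is-sumℚ x y) (Equivalence.to (majority x y) e)
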